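{- There exist infinitely many natural numbers $n$ which cannot be written as $n = z + p$ with $z$ a Zumkeller number and $p$ a prime.
   Context: A natural number $n$ is a Zumkeller number if the set of its positive divisors can be partitioned into two subsets with equal sums. -}

module Defs where

open import Data.Nat using (ℕ; suc; _≤_)
open import Data.Nat.Divisibility using (_∣?_)
open import Data.List using (List; filter; applyUpTo; _++_)
open import Data.Nat.ListAction using (sum)
open import Relation.Binary.PropositionalEquality using (_≡_)
open import Data.List.Relation.Binary.Permutation.Propositional using (_↭_)
open import Data.Product using (∃₂; _×_)

divisors : ℕ → List ℕ
divisors n = filter (_∣? n) (applyUpTo suc n)

Zumkeller : ℕ → Set
Zumkeller n = 1 ≤ n × ∃₂ λ A B → (divisors n ↭ A ++ B) × (sum A ≡ sum B)

-- A Zumkeller number z has σ(z) ≥ 2z.  On the other hand, if every prime factor of w is at least q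
-- and w ≤ q^j, then w has at most j prime factors and σ(w)/w ≤ (1 + 1/q)^j < 4/3 as soon as 4j < q.
-- Take q = 2^(L+3), j = 2^L and n = P² q, where P is the product of the primes ≤ q.  If n = z + p with
-- p prime, then either p < q, so p ∣ z, z = p w and w + 1 = n/p is divisible by every prime below q,
-- whence 2 p w ≤ σ(p w) ≤ (p + 1) σ(w) < (4/3)(p + 1) w, impossible for p ≥ 2; or p ≥ q, and then no
-- prime below q divides z, so σ(z) < (4/3) z.  Erdős' bound P ≤ 8^q (via the binomial coefficients
-- (2m+1 choose m+1)) gives n ≤ q^j once L is large.

module Submission where

open import Defs
open import Data.Nat using (ℕ; zero; suc; _≤_; _<_; _+_; _*_; _∸_; _^_; _!; z≤n; s≤s; z<s; _<?_;
                            NonZero; >-nonZero; >-nonZero⁻¹; nonTrivial⇒n>1)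
open import Data.Nat.Properties
open import Data.Nat.Induction using (<-rec)
open import Data.Nat.Divisibility
open import Data.Nat.DivMod using (_/_; m*[n/m]≡n)
open import Data.Nat.Coprimality using (Coprime; coprime-divisor)
open import Data.Nat.Primality
  using (Prime; _Rough_; prime⇒nonZero; prime⇒nonTrivial; prime⇒irreducible; 0-rough; 1-rough; 2-rough;
         ∤⇒rough-suc; rough∧∣⇒prime; rough∧∣⇒rough; rough⇒≤; ¬prime[1]; prime?; euclidsLemma;
         composite; composite⇒¬prime)
open import Data.Nat.Primality.Factorisation using (factorise)
open import Data.Nat.Combinatorics using (_C_; k![n∸k]!∣n!; nCk≡n!/k![n-k]!; nCk+nC[k+1]≡[n+1]C[k+1])
open import Data.Nat.ListAction using (sum)
open import Data.Nat.ListAction.Properties using (sum-++; sum-↭; ∈⇒∣product)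
open import Data.Nat.Tactic.RingSolver using (solve-∀)
open import Data.List using (List; []; _∷_; _++_; [_]; map; applyUpTo)
open import Data.List.Membership.Propositional using (_∈_)
open import Data.List.Membership.Propositional.Properties
open import Data.List.Relation.Unary.Any using (here; there)
open import Data.List.Relation.Unary.All using (lookup; _∷_)
open import Data.List.Relation.Unary.AllPairs using (_∷_)
open import Data.List.Relation.Unary.Unique.Propositional using (Unique)
import Data.List.Relation.Unary.Unique.Propositional.Properties as Unique
open import Data.List.Relation.Binary.Permutation.Propositional.Properties using (∈-resp-↭)
open import Data.Product using (∃; ∃₂; _×_; _,_)
open import Data.Sum using (_⊎_; inj₁; inj₂)
open import Data.Empty using (⊥; ⊥-elim)
open import Function using (case_of_)
open import Relation.Nullary using (¬_; yes; no)
open import Relation.Nullary.Decidable using (_×-dec_)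
open import Relation.Binary.PropositionalEquality hiding ([_])
import Algebra.Properties.CommutativeSemigroup as CommutativeSemigroupProperties

module +-CS = CommutativeSemigroupProperties +-commutativeSemigroup
module *-CS = CommutativeSemigroupProperties *-commutativeSemigroup

-- Divisor sums

σ : ℕ → ℕ
σ n = sum (divisors n)

∈-divisors⁺ : ∀ {d n} → 1 ≤ d → d ≤ n → d ∣ n → d ∈ divisors n
∈-divisors⁺ {suc d} {n} _ d≤n d∣n = ∈-filter⁺ (_∣? n) (∈-applyUpTo⁺ suc d≤n) d∣n

∈-divisors⁻ : ∀ {d n} → d ∈ divisors n → 1 ≤ d × d ∣ n
∈-divisors⁻ {n = n} d∈ with ∈-filter⁻ (_∣? n) {xs = applyUpTo suc n} d∈
... | d∈range , d∣n with ∈-applyUpTo⁻ suc d∈range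
...   | _ , _ , refl = s≤s z≤n , d∣n

divisors-unique : ∀ n → Unique (divisors n)
divisors-unique n = Unique.filter⁺ (_∣? n)
  (Unique.applyUpTo⁺₁ suc n (λ i<j _ eq → <⇒≢ i<j (suc-injective eq)))

∈⇒≤sum : ∀ {x xs} → x ∈ xs → x ≤ sum xs
∈⇒≤sum {xs = y ∷ ys} (here refl) = m≤m+n y (sum ys)
∈⇒≤sum {xs = y ∷ ys} (there x∈ys) = ≤-trans (∈⇒≤sum x∈ys) (m≤n+m (sum ys) y)

sum-++-middle : ∀ ys x zs → sum (ys ++ [ x ] ++ zs) ≡ x + sum (ys ++ zs)
sum-++-middle ys x zs = begin
  sum (ys ++ [ x ] ++ zs) ≡⟨ sum-++ ys (x ∷ zs) ⟩
  sum ys + (x + sum zs)   ≡⟨ +-CS.x∙yz≈y∙xz (sum ys) x (sum zs) ⟩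
  x + (sum ys + sum zs)   ≡⟨ cong (x +_) (sum-++ ys zs) ⟨
  x + sum (ys ++ zs)      ∎
  where open ≡-Reasoning

∈-++-middle⁻ : ∀ {x y : ℕ} ys zs → y ∈ ys ++ [ x ] ++ zs → y ≢ x → y ∈ ys ++ zs
∈-++-middle⁻ []       zs (here refl)  y≢x = ⊥-elim (y≢x refl)
∈-++-middle⁻ []       zs (there y∈)   _   = y∈
∈-++-middle⁻ (w ∷ ys) zs (here refl)  _   = here refl
∈-++-middle⁻ (w ∷ ys) zs (there y∈)   y≢x = there (∈-++-middle⁻ ys zs y∈ y≢x)

sum-mono-⊆ : ∀ {xs ys : List ℕ} → Unique xs → (∀ {x} → x ∈ xs → x ∈ ys) → sum xs ≤ sum ys
sum-mono-⊆ {[]}     _            _   = z≤n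
sum-mono-⊆ {x ∷ xs} (x∉xs ∷ uxs) xs⊆ys with ∈-∃++ (xs⊆ys (here refl))
... | ys₁ , ys₂ , refl = begin
  x + sum xs               ≤⟨ +-monoʳ-≤ x (sum-mono-⊆ uxs xs⊆ys₁++ys₂) ⟩
  x + sum (ys₁ ++ ys₂)     ≡⟨ sum-++-middle ys₁ x ys₂ ⟨
  sum (ys₁ ++ [ x ] ++ ys₂) ∎
  where
  open ≤-Reasoning
  xs⊆ys₁++ys₂ : ∀ {y} → y ∈ xs → y ∈ ys₁ ++ ys₂
  xs⊆ys₁++ys₂ y∈xs =
    ∈-++-middle⁻ ys₁ ys₂ (xs⊆ys (there y∈xs)) (λ y≡x → lookup x∉xs y∈xs (sym y≡x))

-- n itself lies in one half of the partition, so each half sums to at least n.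
zumkeller⇒2n≤σ : ∀ {n} → Zumkeller n → 2 * n ≤ σ n
zumkeller⇒2n≤σ {n} (1≤n , A , B , divisors↭A++B , ΣA≡ΣB) = begin
  2 * n               ≤⟨ +-mono-≤ n≤ΣA (+-monoˡ-≤ 0 (≤-trans n≤ΣA (≤-reflexive ΣA≡ΣB))) ⟩
  sum A + (sum B + 0) ≡⟨ cong (sum A +_) (+-identityʳ (sum B)) ⟩
  sum A + sum B       ≡⟨ sum-++ A B ⟨
  sum (A ++ B)        ≡⟨ sum-↭ divisors↭A++B ⟨
  σ n                 ∎
  where
  open ≤-Reasoning
  n≤ΣA : n ≤ sum A
  n≤ΣA with ∈-++⁻ A (∈-resp-↭ divisors↭A++B (∈-divisors⁺ 1≤n ≤-refl ∣-refl))
  ... | inj₁ n∈A = ∈⇒≤sum n∈A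
  ... | inj₂ n∈B = ≤-trans (∈⇒≤sum n∈B) (≤-reflexive (sym ΣA≡ΣB))

sum-map-* : ∀ m ns → sum (map (m *_) ns) ≡ m * sum ns
sum-map-* m []       = sym (*-zeroʳ m)
sum-map-* m (n ∷ ns) = trans (cong (m * n +_) (sum-map-* m ns)) (sym (*-distribˡ-+ m n (sum ns)))

prime∤⇒coprime : ∀ {p d} → Prime p → ¬ (p ∣ d) → Coprime d p
prime∤⇒coprime pr p∤d (c∣d , c∣p) with prime⇒irreducible pr c∣p
... | inj₁ c≡1 = c≡1
... | inj₂ refl = ⊥-elim (p∤d c∣d)

divisors-prime-* : ∀ {p n d} .{{_ : NonZero n}} → Prime p → d ∈ divisors (p * n) →
                   d ∈ divisors n ++ map (p *_) (divisors n)
divisors-prime-* {p} {n} {d} pr d∈ with ∈-divisors⁻ d∈ | p ∣? d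
... | 1≤d , d∣pn | no p∤d = ∈-++⁺ˡ (∈-divisors⁺ 1≤d (∣⇒≤ d∣n) d∣n)
  where
  instance _ = prime⇒nonZero pr
  d∣n = coprime-divisor (prime∤⇒coprime pr p∤d) d∣pn
... | 1≤ep , ep∣pn | yes (divides e refl) =
  ∈-++⁺ʳ (divisors n) (subst (_∈ map (p *_) (divisors n)) (*-comm p e)
    (∈-map⁺ (p *_) (∈-divisors⁺ 1≤e (∣⇒≤ e∣n) e∣n)))
  where
  instance _ = prime⇒nonZero pr
  e∣n : e ∣ n
  e∣n = *-cancelˡ-∣ p (subst (_∣ p * n) (*-comm e p) ep∣pn)
  1≤e : 1 ≤ e
  1≤e = >-nonZero⁻¹ e {{m*n≢0⇒m≢0 e {{>-nonZero 1≤ep}}}}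

σ-prime-* : ∀ p n → Prime p → σ (p * n) ≤ suc p * σ n
σ-prime-* p zero _ rewrite *-zeroʳ p = z≤n
σ-prime-* p n@(suc _) pr = begin
  σ (p * n)                                   ≤⟨ sum-mono-⊆ (divisors-unique (p * n)) (divisors-prime-* pr) ⟩
  sum (divisors n ++ map (p *_) (divisors n)) ≡⟨ sum-++ (divisors n) _ ⟩
  σ n + sum (map (p *_) (divisors n))         ≡⟨ cong (σ n +_) (sum-map-* p (divisors n)) ⟩
  suc p * σ n                                 ∎
  where
  open ≤-Reasoning
  instance _ = prime⇒nonZero pr

-- Rough numbers have small abundancy

prime∤1 : ∀ {p} → Prime p → ¬ p ∣ 1
prime∤1 pr p∣1 = ¬prime[1] (subst Prime (∣1⇒≡1 p∣1) pr)

prime⇒2≤p : ∀ {p} → Prime p → 2 ≤ p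
prime⇒2≤p {p} pr = nonTrivial⇒n>1 p {{prime⇒nonTrivial pr}}

primes∤⇒rough : ∀ q {n} → (∀ {r} → Prime r → r < q → ¬ r ∣ n) → q Rough n
primes∤⇒rough zero             _ = 0-rough
primes∤⇒rough (suc zero)       _ = 1-rough
primes∤⇒rough (suc (suc zero)) _ = 2-rough
primes∤⇒rough (suc q@(suc (suc _))) primes∤ =
  let q-rough = primes∤⇒rough q (λ pr r<q → primes∤ pr (m<n⇒m<1+n r<q))
  in  ∤⇒rough-suc (λ q∣n → primes∤ (rough∧∣⇒prime q-rough q∣n) (n<1+n q) q∣n) q-rough

prime-factor : ∀ n → 2 ≤ n → ∃ λ p → Prime p × p ∣ n
prime-factor (suc zero) (s≤s ())
prime-factor n@(suc (suc _)) _ with factorise n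
... | record { factors = p ∷ ps ; isFactorisation = n≡∏ ; factorsPrime = pr ∷ _ } =
  p , pr , subst (p ∣_) (sym n≡∏) (∈⇒∣product {ns = p ∷ ps} (here refl))

rough-prime-factor≥ : ∀ {q n p} → q Rough n → Prime p → p ∣ n → q ≤ p
rough-prime-factor≥ rough pr p∣n = rough⇒≤ {{prime⇒nonTrivial pr}} (rough∧∣⇒rough rough p∣n)

q^j*σ≤[1+q]^j*n-step : ∀ {q p} j {m} → q ≤ p → Prime p → q ^ j * σ m ≤ suc q ^ j * m →
                        q ^ suc j * σ (p * m) ≤ suc q ^ suc j * (p * m)
q^j*σ≤[1+q]^j*n-step {q} {p} j {m} q≤p pr ih = begin
  q * q ^ j * σ (p * m)       ≤⟨ *-monoʳ-≤ (q * q ^ j) (σ-prime-* p m pr) ⟩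
  q * q ^ j * (suc p * σ m)   ≡⟨ *-CS.interchange q (q ^ j) (suc p) (σ m) ⟩
  q * suc p * (q ^ j * σ m)   ≤⟨ *-mono-≤ q*[1+p]≤[1+q]*p ih ⟩
  suc q * p * (suc q ^ j * m) ≡⟨ *-CS.interchange (suc q) p (suc q ^ j) m ⟩
  suc q * suc q ^ j * (p * m) ∎
  where
  open ≤-Reasoning
  q*[1+p]≤[1+q]*p : q * suc p ≤ suc q * p
  q*[1+p]≤[1+q]*p = ≤-trans (≤-reflexive (*-suc q p)) (+-monoˡ-≤ (q * p) q≤p)

-- Induction on the number of prime factors: each prime factor p ≥ q multiplies σ n / n
-- by at most (1 + p)/p ≤ (1 + q)/q.
rough⇒q^j*σ≤[1+q]^j*n : ∀ {q} .{{_ : NonZero q}} j {n} → q Rough n → 1 ≤ n → n ≤ q ^ j →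
                         q ^ j * σ n ≤ suc q ^ j * n
rough⇒q^j*σ≤[1+q]^j*n {q} j {suc zero} _ _ _ = *-monoˡ-≤ 1 (^-monoˡ-≤ j (n≤1+n q))
rough⇒q^j*σ≤[1+q]^j*n zero {suc (suc _)} _ _ (s≤s ())
rough⇒q^j*σ≤[1+q]^j*n {q} (suc j) {n@(suc (suc _))} rough _ n≤q^[1+j]
  with prime-factor n (s≤s (s≤s z≤n))
... | p , pr , divides m n≡m*p =
  subst (λ k → q ^ suc j * σ k ≤ suc q ^ suc j * k) (sym n≡p*m)
    (q^j*σ≤[1+q]^j*n-step j q≤p pr (rough⇒q^j*σ≤[1+q]^j*n j m-rough 1≤m m≤q^j))
  where
  n≡p*m = trans n≡m*p (*-comm m p)
  q≤p = rough-prime-factor≥ rough pr (divides m n≡m*p)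
  m-rough = rough∧∣⇒rough rough (divides p n≡p*m)
  instance _ = prime⇒nonZero pr
  1≤m : 1 ≤ m
  1≤m = >-nonZero⁻¹ m {{m*n≢0⇒m≢0 m {{subst NonZero n≡m*p _}}}}
  m≤q^j : m ≤ q ^ j
  m≤q^j = *-cancelˡ-≤ q (begin
    q * m ≤⟨ *-monoˡ-≤ m q≤p ⟩
    p * m ≡⟨ n≡p*m ⟨
    n     ≤⟨ n≤q^[1+j] ⟩
    q ^ suc j ∎)
    where open ≤-Reasoning

-- (1 + 1/q)^j ≤ q/(q − j), with e = q − j and both sides multiplied out.
[1+q]^j*e≤q^j*q : ∀ q j e → j + e ≡ q → suc q ^ j * e ≤ q ^ j * q
[1+q]^j*e≤q^j*q q zero    e refl  = ≤-refl
[1+q]^j*e≤q^j*q q (suc j) e j+e≡q = begin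
  suc q * suc q ^ j * e       ≡⟨ *-CS.xy∙z≈y∙xz (suc q) (suc q ^ j) e ⟩
  suc q ^ j * (suc q * e)     ≤⟨ *-monoʳ-≤ (suc q ^ j) [1+q]*e≤[1+e]*q ⟩
  suc q ^ j * (suc e * q)     ≡⟨ *-CS.x∙yz≈z∙xy (suc q ^ j) (suc e) q ⟩
  q * (suc q ^ j * suc e)     ≤⟨ *-monoʳ-≤ q ([1+q]^j*e≤q^j*q q j (suc e) (trans (+-suc j e) j+e≡q)) ⟩
  q * (q ^ j * q)             ≡⟨ *-assoc q (q ^ j) q ⟨
  q * q ^ j * q               ∎
  where
  open ≤-Reasoning
  [1+q]*e≤[1+e]*q : suc q * e ≤ suc e * q
  [1+q]*e≤[1+e]*q = begin
    e + q * e ≤⟨ +-monoˡ-≤ (q * e) (≤-trans (m≤n+m e (suc j)) (≤-reflexive j+e≡q)) ⟩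
    q + q * e ≡⟨ cong (q +_) (*-comm q e) ⟩
    q + e * q ∎

3*[1+q]^j<4*q^j : ∀ {q j} → 4 * j < q → 3 * suc q ^ j < 4 * q ^ j
3*[1+q]^j<4*q^j {q} {j} 4j<q = *-cancelʳ-< q (3 * suc q ^ j) (4 * q ^ j) (begin-strict
  3 * suc q ^ j * q       ≡⟨ *-CS.xy∙z≈y∙xz 3 (suc q ^ j) q ⟩
  suc q ^ j * (3 * q)     <⟨ *-monoʳ-< (suc q ^ j) 3q<4e ⟩
  suc q ^ j * (4 * e)     ≡⟨ *-CS.x∙yz≈y∙xz (suc q ^ j) 4 e ⟩
  4 * (suc q ^ j * e)     ≤⟨ *-monoʳ-≤ 4 ([1+q]^j*e≤q^j*q q j e j+e≡q) ⟩
  4 * (q ^ j * q)         ≡⟨ *-assoc 4 (q ^ j) q ⟨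
  4 * q ^ j * q           ∎)
  where
  open ≤-Reasoning
  instance _ = m^n≢0 (suc q) j
  e = q ∸ j
  j+e≡q : j + e ≡ q
  j+e≡q = m+[n∸m]≡n (≤-trans (m≤n*m j 4) (<⇒≤ 4j<q))
  3q<4e : 3 * q < 4 * e
  3q<4e = +-cancelˡ-< (4 * j) (3 * q) (4 * e) (begin-strict
    4 * j + 3 * q <⟨ +-monoˡ-< (3 * q) 4j<q ⟩
    q + 3 * q     ≡⟨⟩
    4 * q         ≡⟨ cong (4 *_) j+e≡q ⟨
    4 * (j + e)   ≡⟨ *-distribˡ-+ 4 j e ⟩
    4 * j + 4 * e ∎)

rough⇒3σ<4n : ∀ {q} j {n} → 4 * j < q → q Rough n → 1 ≤ n → n ≤ q ^ j → 3 * σ n < 4 * n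
rough⇒3σ<4n {q} j {n} 4j<q rough 1≤n n≤q^j = *-cancelˡ-< (q ^ j) (3 * σ n) (4 * n) (begin-strict
  q ^ j * (3 * σ n)   ≡⟨ *-CS.x∙yz≈y∙xz (q ^ j) 3 (σ n) ⟩
  3 * (q ^ j * σ n)   ≤⟨ *-monoʳ-≤ 3 (rough⇒q^j*σ≤[1+q]^j*n j rough 1≤n n≤q^j) ⟩
  3 * (suc q ^ j * n) ≡⟨ *-assoc 3 (suc q ^ j) n ⟨
  3 * suc q ^ j * n   <⟨ *-monoˡ-< n (3*[1+q]^j<4*q^j {q} {j} 4j<q) ⟩
  4 * q ^ j * n       ≡⟨ *-CS.xy∙z≈y∙xz 4 (q ^ j) n ⟩
  q ^ j * (4 * n)     ∎)
  where
  open ≤-Reasoning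
  instance _ = >-nonZero (<-≤-trans z<s 4j<q)
  instance _ = >-nonZero 1≤n

-- With s = σ n this reads s/n < 4/3 ≤ 2c/k ≤ s/n, fractions cleared.
abundancy-contradiction : ∀ {n s c k} .{{_ : NonZero k}} → 3 * s < 4 * n → 2 * c * n ≤ k * s →
                          2 * k ≤ 3 * c → ⊥
abundancy-contradiction {n} {s} {c} {k} 3s<4n 2cn≤ks 2k≤3c = <-irrefl refl (begin-strict
  3 * (2 * c * n) ≤⟨ *-monoʳ-≤ 3 2cn≤ks ⟩
  3 * (k * s)     ≡⟨ *-CS.x∙yz≈y∙xz 3 k s ⟩
  k * (3 * s)     <⟨ *-monoʳ-< k 3s<4n ⟩
  k * (4 * n)     ≡⟨ k*4n≡2k*2n k n ⟩
  2 * k * (2 * n) ≤⟨ *-monoˡ-≤ (2 * n) 2k≤3c ⟩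
  3 * c * (2 * n) ≡⟨ 3c*2n≡3*[2cn] c n ⟩
  3 * (2 * c * n) ∎)
  where
  open ≤-Reasoning
  k*4n≡2k*2n : ∀ k n → k * (4 * n) ≡ 2 * k * (2 * n)
  k*4n≡2k*2n = solve-∀
  3c*2n≡3*[2cn] : ∀ c n → 3 * c * (2 * n) ≡ 3 * (2 * c * n)
  3c*2n≡3*[2cn] = solve-∀

-- Sums of a Zumkeller number and a prime

Zumkeller+Prime : ℕ → Set
Zumkeller+Prime n = ∃₂ λ z p → Zumkeller z × Prime p × n ≡ z + p

module _ {q j n} (4j<q : 4 * j < q) (n≤q^j : n ≤ q ^ j)
         (small²∣n : ∀ {r s} → Prime r → Prime s → r < q → s < q → r * s ∣ n) where

  private
    small∣n : ∀ {r} → Prime r → r < q → r ∣ n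
    small∣n pr r<q = ∣-trans (m∣m*n _) (small²∣n pr pr r<q r<q)

    summand≤q^j : ∀ {z p} → n ≡ z + p → z ≤ q ^ j
    summand≤q^j {z} {p} n≡z+p = ≤-trans (m≤m+n z p) (≤-trans (≤-reflexive (sym n≡z+p)) n≤q^j)

  -- z = w p with w + 1 = n / p divisible by every prime below q, so w is q-rough.
  ¬zumkeller+small-prime : ∀ {z p} → Zumkeller z → Prime p → p < q → n ≡ z + p → ⊥
  ¬zumkeller+small-prime {z} {p} zum@(1≤z , _) pr p<q n≡z+p
    with ∣m+n∣m⇒∣n (subst (p ∣_) (trans n≡z+p (+-comm z p)) (small∣n pr p<q)) ∣-refl
  ... | divides w z≡w*p =
    abundancy-contradiction {w} {c = p} {k = suc p}
      (rough⇒3σ<4n j 4j<q w-rough 1≤w w≤q^j) 2pw≤[1+p]σw 2[1+p]≤3p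
    where
    instance _ = prime⇒nonZero pr
    n≡[1+w]*p : n ≡ suc w * p
    n≡[1+w]*p = trans n≡z+p (trans (cong (_+ p) z≡w*p) (+-comm (w * p) p))
    w-rough : q Rough w
    w-rough = primes∤⇒rough q λ {r} pr′ r<q r∣w →
      prime∤1 pr′ (∣m+n∣m⇒∣n (subst (r ∣_) (+-comm 1 w)
        (*-cancelʳ-∣ p (subst (r * p ∣_) n≡[1+w]*p (small²∣n pr′ pr r<q p<q)))) r∣w)
    1≤w : 1 ≤ w
    1≤w = >-nonZero⁻¹ w {{m*n≢0⇒m≢0 w {{subst NonZero z≡w*p (>-nonZero 1≤z)}}}}
    w≤q^j : w ≤ q ^ j
    w≤q^j = ≤-trans (m≤m*n w p) (≤-trans (≤-reflexive (sym z≡w*p)) (summand≤q^j n≡z+p))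
    2pw≤[1+p]σw : 2 * p * w ≤ suc p * σ w
    2pw≤[1+p]σw = begin
      2 * p * w     ≡⟨ *-assoc 2 p w ⟩
      2 * (p * w)   ≡⟨ cong (2 *_) (trans (*-comm p w) (sym z≡w*p)) ⟩
      2 * z         ≤⟨ zumkeller⇒2n≤σ zum ⟩
      σ z           ≡⟨ cong σ (trans z≡w*p (*-comm w p)) ⟩
      σ (p * w)     ≤⟨ σ-prime-* p w pr ⟩
      suc p * σ w   ∎
      where open ≤-Reasoning
    2[1+p]≤3p : 2 * suc p ≤ 3 * p
    2[1+p]≤3p = begin
      2 * suc p   ≡⟨ *-suc 2 p ⟩
      2 + 2 * p   ≤⟨ +-monoˡ-≤ (2 * p) (prime⇒2≤p pr) ⟩
      p + 2 * p   ≡⟨⟩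
      3 * p       ∎
      where open ≤-Reasoning

  -- A prime r < q dividing z divides n = z + p, hence p, forcing r = p ≥ q; so z is q-rough.
  ¬zumkeller+large-prime : ∀ {z p} → Zumkeller z → Prime p → q ≤ p → n ≡ z + p → ⊥
  ¬zumkeller+large-prime {z} {p} zum@(1≤z , _) pr q≤p n≡z+p =
    abundancy-contradiction {z} {c = 1} {k = 1} (rough⇒3σ<4n j 4j<q z-rough 1≤z (summand≤q^j n≡z+p))
      (≤-trans (zumkeller⇒2n≤σ zum) (≤-reflexive (sym (*-identityˡ (σ z))))) (n≤1+n 2)
    where
    z-rough : q Rough z
    z-rough = primes∤⇒rough q λ {r} pr′ r<q r∣z →
      case prime⇒irreducible pr (∣m+n∣m⇒∣n (subst (r ∣_) n≡z+p (small∣n pr′ r<q)) r∣z) of λ where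
        (inj₁ refl) → ¬prime[1] pr′
        (inj₂ refl) → <⇒≱ r<q q≤p

  ¬zumkeller+prime : ¬ Zumkeller+Prime n
  ¬zumkeller+prime (z , p , zum , pr , n≡z+p) with p <? q
  ... | yes p<q = ¬zumkeller+small-prime zum pr p<q n≡z+p
  ... | no  p≮q = ¬zumkeller+large-prime zum pr (≮⇒≥ p≮q) n≡z+p

-- Products of primes

primeOver : ℕ → ℕ → ℕ
primeOver a n with a <? n ×-dec prime? n
... | yes _ = n
... | no  _ = 1

primeProduct : ℕ → ℕ → ℕ
primeProduct a zero    = 1
primeProduct a (suc n) = primeProduct a n * primeOver a (suc n)

primorial : ℕ → ℕ
primorial = primeProduct 0

primeOver-≢0 : ∀ a n → NonZero (primeOver a n)
primeOver-≢0 a n with a <? n ×-dec prime? n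
... | yes (a<n , _) = >-nonZero (<-≤-trans z<s a<n)
... | no  _         = _

primeProduct-≢0 : ∀ a n → NonZero (primeProduct a n)
primeProduct-≢0 a zero    = _
primeProduct-≢0 a (suc n) = m*n≢0 _ _ {{primeProduct-≢0 a n}} {{primeOver-≢0 a (suc n)}}

primeOver-≤ : ∀ {a n} → n ≤ a → primeOver a n ≡ 1
primeOver-≤ {a} {n} n≤a with a <? n ×-dec prime? n
... | yes (a<n , _) = ⊥-elim (<⇒≱ a<n n≤a)
... | no  _         = refl

primeOver-< : ∀ {a b n} → a < n → b < n → primeOver a n ≡ primeOver b n
primeOver-< {a} {b} {n} a<n b<n with a <? n ×-dec prime? n | b <? n ×-dec prime? n
... | yes _              | yes _              = refl
... | no  _              | no  _              = refl
... | yes (_ , pr)       | no  ¬b<n×pr        = ⊥-elim (¬b<n×pr (b<n , pr))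
... | no  ¬a<n×pr        | yes (_ , pr)       = ⊥-elim (¬a<n×pr (a<n , pr))

primeProduct-≤ : ∀ {a n} → n ≤ a → primeProduct a n ≡ 1
primeProduct-≤ {a} {zero}  _   = refl
primeProduct-≤ {a} {suc n} n<a = cong₂ _*_ (primeProduct-≤ (<⇒≤ n<a)) (primeOver-≤ n<a)

primorial-+ : ∀ a d → primorial (a + d) ≡ primorial a * primeProduct a (a + d)
primorial-+ a zero rewrite +-identityʳ a | primeProduct-≤ {a} {a} ≤-refl = sym (*-identityʳ _)
primorial-+ a (suc d) rewrite +-suc a d = begin
  primorial (a + d) * primeOver 0 (suc (a + d))
    ≡⟨ cong₂ _*_ (primorial-+ a d) (primeOver-< z<s (s≤s (m≤m+n a d))) ⟩
  primorial a * primeProduct a (a + d) * primeOver a (suc (a + d))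
    ≡⟨ *-assoc (primorial a) _ _ ⟩
  primorial a * primeProduct a (suc (a + d)) ∎
  where open ≡-Reasoning

primeOver-prime : ∀ {a p} → a < p → Prime p → primeOver a p ≡ p
primeOver-prime {a} {p} a<p pr with a <? p ×-dec prime? p
... | yes _      = refl
... | no  ¬a<p×pr = ⊥-elim (¬a<p×pr (a<p , pr))

primeOver-¬prime : ∀ {a n} → ¬ Prime n → primeOver a n ≡ 1
primeOver-¬prime {a} {n} ¬pr with a <? n ×-dec prime? n
... | yes (_ , pr) = ⊥-elim (¬pr pr)
... | no  _        = refl

prime≤⇒∣primorial : ∀ {p n} → Prime p → p ≤ n → p ∣ primorial n
prime≤⇒∣primorial {p} {zero}  pr p≤0 = ⊥-elim (<⇒≱ (<-≤-trans z<s (prime⇒2≤p pr)) p≤0)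
prime≤⇒∣primorial {p} {suc n} pr p≤1+n with m≤n⇒m<n∨m≡n p≤1+n
... | inj₁ p<1+n = ∣m⇒∣m*n _ (prime≤⇒∣primorial pr (≤-pred p<1+n))
... | inj₂ refl  = subst (p ∣_) (cong (primorial n *_) (sym (primeOver-prime z<s pr))) (n∣m*n (primorial n))

prime∣primeOver⇒≤ : ∀ {a p n} → Prime p → p ∣ primeOver a n → p ≤ n
prime∣primeOver⇒≤ {a} {p} {n} pr p∣ with a <? n ×-dec prime? n
... | yes (a<n , _) = ∣⇒≤ {{>-nonZero (<-≤-trans z<s a<n)}} p∣
... | no  _         = ⊥-elim (prime∤1 pr p∣)

prime∣primeProduct⇒≤ : ∀ {a p} n → Prime p → p ∣ primeProduct a n → p ≤ n
prime∣primeProduct⇒≤ zero    pr p∣1 = ⊥-elim (prime∤1 pr p∣1)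
prime∣primeProduct⇒≤ (suc n) pr p∣ with euclidsLemma (primeProduct _ n) (primeOver _ (suc n)) pr p∣
... | inj₁ p∣product = m≤n⇒m≤1+n (prime∣primeProduct⇒≤ n pr p∣product)
... | inj₂ p∣over    = prime∣primeOver⇒≤ pr p∣over

prime∤k! : ∀ {p} k → Prime p → k < p → ¬ p ∣ k !
prime∤k! zero    pr _   p∣1 = prime∤1 pr p∣1
prime∤k! (suc k) pr k<p p∣ with euclidsLemma (suc k) (k !) pr p∣
... | inj₁ p∣1+k = <⇒≱ k<p (∣⇒≤ p∣1+k)
... | inj₂ p∣k!  = prime∤k! k pr (<-trans (n<1+n k) k<p) p∣k!

n∣n! : ∀ {n} → 1 ≤ n → n ∣ n !
n∣n! {suc n} _ = m∣m*n (n !)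

k!*[n∸k]!*nCk≡n! : ∀ {n k} → k ≤ n → k ! * (n ∸ k) ! * (n C k) ≡ n !
k!*[n∸k]!*nCk≡n! {n} {k} k≤n = begin
  k ! * (n ∸ k) ! * (n C k)                          ≡⟨ cong (k ! * (n ∸ k) ! *_) (nCk≡n!/k![n-k]! k≤n) ⟩
  k ! * (n ∸ k) ! * (n ! / (k ! * (n ∸ k) !))      ≡⟨ m*[n/m]≡n (k![n∸k]!∣n! k≤n) ⟩
  n !                                              ∎
  where
  open ≡-Reasoning
  instance _ = k !* (n ∸ k) !≢0

-- p divides n! but, being larger than k and n − k, neither k! nor (n − k)!.
prime∣nCk : ∀ {n k p} → Prime p → k ≤ n → k < p → n ∸ k < p → p ≤ n → p ∣ n C k
prime∣nCk {n} {k} {p} pr k≤n k<p n∸k<p p≤n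
  with euclidsLemma (k ! * (n ∸ k) !) (n C k) pr
         (subst (p ∣_) (sym (k!*[n∸k]!*nCk≡n! k≤n))
           (∣-trans (n∣n! (<⇒≤ (prime⇒2≤p pr))) (m≤n⇒m!∣n! p≤n)))
... | inj₂ p∣nCk = p∣nCk
... | inj₁ p∣k!*[n∸k]! with euclidsLemma (k !) ((n ∸ k) !) pr p∣k!*[n∸k]!
...   | inj₁ p∣k!     = ⊥-elim (prime∤k! k pr k<p p∣k!)
...   | inj₂ p∣[n∸k]! = ⊥-elim (prime∤k! (n ∸ k) pr n∸k<p p∣[n∸k]!)

prime∤∧∣∧∣⇒*∣ : ∀ {a p c} → Prime p → ¬ p ∣ a → a ∣ c → p ∣ c → a * p ∣ c
prime∤∧∣∧∣⇒*∣ {a} {p} pr p∤a (divides t refl) p∣t*a with euclidsLemma t a pr p∣t*a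
... | inj₁ (divides s refl) = divides s (trans (*-assoc s p a) (cong (s *_) (*-comm p a)))
... | inj₂ p∣a              = ⊥-elim (p∤a p∣a)

nCk≢0 : ∀ {n k} → k ≤ n → NonZero (n C k)
nCk≢0 {n} {k} k≤n =
  m*n≢0⇒n≢0 (k ! * (n ∸ k) !) {{subst NonZero (sym (k!*[n∸k]!*nCk≡n! k≤n)) (n !≢0)}}

nCk≤2^n : ∀ n k → n C k ≤ 2 ^ n
nCk≤2^n n       zero    = m^n>0 2 n
nCk≤2^n zero    (suc k) = z≤n
nCk≤2^n (suc n) (suc k) = begin
  suc n C suc k       ≡⟨ nCk+nC[k+1]≡[n+1]C[k+1] n k ⟨
  n C k + n C suc k   ≤⟨ +-mono-≤ (nCk≤2^n n k) (nCk≤2^n n (suc k)) ⟩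
  2 ^ n + 2 ^ n       ≡⟨ cong (2 ^ n +_) (+-identityʳ (2 ^ n)) ⟨
  2 ^ suc n           ∎
  where open ≤-Reasoning

primeProduct∣binomial : ∀ m n → n ≤ suc (m + m) → primeProduct (suc m) n ∣ suc (m + m) C suc m
primeProduct∣binomial m zero    _        = 1∣ _
primeProduct∣binomial m (suc n) 1+n≤2m+1 with suc m <? suc n ×-dec prime? (suc n)
... | no  _          = subst (_∣ suc (m + m) C suc m) (sym (*-identityʳ _)) ih
  where ih = primeProduct∣binomial m n (≤-trans (n≤1+n n) 1+n≤2m+1)
... | yes (m<n , pr) = prime∤∧∣∧∣⇒*∣ pr (λ 1+n∣ → <⇒≱ (n<1+n n) (prime∣primeProduct⇒≤ n pr 1+n∣))
    (primeProduct∣binomial m n (≤-trans (n≤1+n n) 1+n≤2m+1))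
    (prime∣nCk pr (s≤s (m≤m+n m m)) m<n
      (subst (_< suc n) (sym (m+n∸m≡n m m)) (<-trans (n<1+n m) m<n)) 1+n≤2m+1)

primorial-odd-step : ∀ m → 1 ≤ m → primorial (suc m) ≤ 2 ^ (3 * suc m) →
                     primorial (suc (m + m)) ≤ 2 ^ (3 * suc (m + m))
primorial-odd-step m@(suc k) _ ih = begin
  primorial (suc (m + m))
    ≡⟨ primorial-+ (suc m) m ⟩
  primorial (suc m) * primeProduct (suc m) (suc (m + m))
    ≤⟨ *-mono-≤ ih (∣⇒≤ {{C≢0}} (primeProduct∣binomial m _ ≤-refl)) ⟩
  2 ^ (3 * suc m) * (suc (m + m) C suc m)
    ≤⟨ *-monoʳ-≤ (2 ^ (3 * suc m)) (nCk≤2^n (suc (m + m)) (suc m)) ⟩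
  2 ^ (3 * suc m) * 2 ^ suc (m + m)
    ≡⟨ ^-distribˡ-+-* 2 (3 * suc m) (suc (m + m)) ⟨
  2 ^ (3 * suc m + suc (m + m))
    ≤⟨ ^-monoʳ-≤ 2 (exponent≤ k) ⟩
  2 ^ (3 * suc (m + m)) ∎
  where
  open ≤-Reasoning
  C≢0 = nCk≢0 (s≤s (m≤m+n m m))
  exponent≤ : ∀ k → 3 * (2 + k) + (2 + (k + suc k)) ≤ 3 * (2 + (k + suc k))
  exponent≤ k = ≤-trans (m≤m+n _ k) (≤-reflexive (rearrange k))
    where
    rearrange : ∀ k → 3 * (2 + k) + (2 + (k + suc k)) + k ≡ 3 * (2 + (k + suc k))
    rearrange = solve-∀

primorial-¬prime : ∀ n → ¬ Prime (suc n) → primorial (suc n) ≡ primorial n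
primorial-¬prime n ¬pr = trans (cong (primorial n *_) (primeOver-¬prime ¬pr)) (*-identityʳ _)

even-or-odd : ∀ n → ∃ λ m → n ≡ m + m ⊎ n ≡ suc (m + m)
even-or-odd zero = 0 , inj₁ refl
even-or-odd (suc n) with even-or-odd n
... | m , inj₁ n≡m+m   = m , inj₂ (cong suc n≡m+m)
... | m , inj₂ n≡1+m+m = suc m , inj₁ (cong suc (trans n≡1+m+m (sym (+-suc m m))))

-- Erdős' argument: primorial (2m + 1) ≤ primorial (m + 1) · (2m+1 choose m+1), and even n > 2 are not prime.
primorial≤2^3n : ∀ n → primorial n ≤ 2 ^ (3 * n)
primorial≤2^3n = <-rec _ bound
  where
  bound : ∀ n → (∀ {k} → k < n → primorial k ≤ 2 ^ (3 * k)) → primorial n ≤ 2 ^ (3 * n)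
  bound n ih with even-or-odd n
  ... | 0 , inj₁ refl = ≤-refl
  ... | 0 , inj₂ refl = s≤s z≤n
  ... | 1 , inj₁ refl = s≤s (s≤s z≤n)
  ... | m@(suc k) , inj₂ refl = primorial-odd-step m (s≤s z≤n) (ih (s≤s (s≤s (m≤n+m m k))))
  ... | m@(suc (suc k)) , inj₁ refl = begin
    primorial (m + m)           ≡⟨ primorial-¬prime (suc k + m) ¬prime ⟩
    primorial (suc k + m)       ≤⟨ ih (n<1+n (suc k + m)) ⟩
    2 ^ (3 * (suc k + m))       ≤⟨ ^-monoʳ-≤ 2 (*-monoʳ-≤ 3 (n≤1+n (suc k + m))) ⟩
    2 ^ (3 * (m + m))           ∎
    where
    open ≤-Reasoning
    ¬prime : ¬ Prime (m + m)
    2≤m : 2 ≤ m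
    2≤m = s≤s (s≤s z≤n)
    ¬prime = composite⇒¬prime
      (composite {2} (≤-trans (n≤1+n 3) (+-mono-≤ 2≤m 2≤m)) (divides m (m+m≡m*2 m)))
      where
      m+m≡m*2 : ∀ m → m + m ≡ m * 2
      m+m≡m*2 = solve-∀

n<2^n : ∀ n → n < 2 ^ n
n<2^n zero    = s≤s z≤n
n<2^n (suc n) = +-mono-≤ (m^n>0 2 n) (≤-trans (n<2^n n) (≤-reflexive (sym (+-identityʳ (2 ^ n)))))

-- j = 2^L and q = 2^(3+L) = 8j, so that 4j < q while primorial(q)² q ≤ 2^(6q + 3 + L) = 2^(48j + 3 + L) ≤ q^j.
-- L is a module parameter rather than the concrete 47 + m because normalising 2 ^ (47 + m) is exponentially slow.
module Witness (L : ℕ) (47≤L : 47 ≤ L) where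

  j q n : ℕ
  j = 2 ^ L
  q = 2 ^ (3 + L)
  n = primorial q * primorial q * q

  4j<q : 4 * j < q
  4j<q = ≤-trans (*-monoˡ-< j {{m^n≢0 2 L}} {4} {8} (s≤s (s≤s (s≤s (s≤s (s≤s z≤n))))))
                 (≤-reflexive (8j≡ j))
    where
    8j≡ : ∀ j → 8 * j ≡ 2 * (2 * (2 * j))
    8j≡ = solve-∀

  exponent≤ : 6 * q + (3 + L) ≤ (3 + L) * j
  exponent≤ = begin
    6 * q + (3 + L)     ≡⟨ cong (_+ (3 + L)) (6*8j≡ j) ⟩
    48 * j + (3 + L)    ≤⟨ +-monoʳ-≤ (48 * j) (+-mono-≤ 2≤j (n<2^n L)) ⟩
    48 * j + (j + j)    ≡⟨ regroup j ⟩
    3 * j + 47 * j      ≤⟨ +-monoʳ-≤ (3 * j) (*-monoˡ-≤ j 47≤L) ⟩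
    3 * j + L * j       ≡⟨ *-distribʳ-+ j 3 L ⟨
    (3 + L) * j         ∎
    where
    open ≤-Reasoning
    2≤j : 2 ≤ j
    2≤j = ^-monoʳ-≤ 2 (≤-trans (s≤s z≤n) 47≤L)
    6*8j≡ : ∀ j → 6 * (2 * (2 * (2 * j))) ≡ 48 * j
    6*8j≡ = solve-∀
    regroup : ∀ j → 48 * j + (j + j) ≡ 3 * j + 47 * j
    regroup = solve-∀

  n≤q^j : n ≤ q ^ j
  n≤q^j = begin
    primorial q * primorial q * q       ≤⟨ *-monoˡ-≤ q (*-mono-≤ (primorial≤2^3n q) (primorial≤2^3n q)) ⟩
    2 ^ (3 * q) * 2 ^ (3 * q) * q       ≡⟨ cong (_* q) (^-distribˡ-+-* 2 (3 * q) (3 * q)) ⟨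
    2 ^ (3 * q + 3 * q) * 2 ^ (3 + L)   ≡⟨ ^-distribˡ-+-* 2 (3 * q + 3 * q) (3 + L) ⟨
    2 ^ (3 * q + 3 * q + (3 + L))       ≡⟨ cong (λ e → 2 ^ (e + (3 + L))) (*-distribʳ-+ q 3 3) ⟨
    2 ^ (6 * q + (3 + L))               ≤⟨ ^-monoʳ-≤ 2 exponent≤ ⟩
    2 ^ ((3 + L) * j)                   ≡⟨ ^-*-assoc 2 (3 + L) j ⟨
    q ^ j                               ∎
    where open ≤-Reasoning

  small²∣n : ∀ {r s} → Prime r → Prime s → r < q → s < q → r * s ∣ n
  small²∣n pr ps r<q s<q =
    ∣m⇒∣m*n q (*-pres-∣ (prime≤⇒∣primorial pr (<⇒≤ r<q)) (prime≤⇒∣primorial ps (<⇒≤ s<q)))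

  L≤n : L ≤ n
  L≤n = begin
    L     ≤⟨ m≤n+m L 3 ⟩
    3 + L ≤⟨ <⇒≤ (n<2^n (3 + L)) ⟩
    q     ≤⟨ m≤n*m q (primorial q * primorial q) ⟩
    n     ∎
    where
    open ≤-Reasoning
    instance _ = m*n≢0 (primorial q) (primorial q) {{primeProduct-≢0 0 q}} {{primeProduct-≢0 0 q}}

  non-sum-above : ∀ {m} → m ≤ L → ∃ λ k → m ≤ k × ¬ Zumkeller+Prime k
  non-sum-above m≤L = n , ≤-trans m≤L L≤n , ¬zumkeller+prime {q} {j} {n} 4j<q n≤q^j small²∣n

theorem4p19 : ∀ (m : ℕ) → ∃ λ (n : ℕ) → m ≤ n × ¬ (∃₂ λ (z p : ℕ) → Zumkeller z × Prime p × n ≡ z + p)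
theorem4p19 m = Witness.non-sum-above (47 + m) (m≤m+n 47 m) (m≤n+m m 47)
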